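{- Let $\Gamma$ be a connected weighted graph, $q\in V(\Gamma)$, and let $D,D'$ be $q$-reduced divisors with $D'=D-L\sigma$ for a firing script $\sigma$. Then $c_\ell(q)$ divides $\sigma(q)$.
   Context: A weighted graph $\Gamma$ is a finite connected multigraph without loops, with vertex set $V(\Gamma)$, edge set $E(\Gamma)$, and weights $w: V(\Gamma)\cup E(\Gamma)\to\mathbb{Z}_{>0}$ such that the weight of each edge divides the weights of both of its endpoints. $E(v)$ denotes the edges incident to $v$, $E(u,v)$ the edges joining $u$ and $v$, and $\mathrm{val}(v)=\sum_{e\in E(v)} w(v)/w(e)$. A divisor is $D:V(\Gamma)\to\mathbb{Z}$. A firing script is $\sigma:V(\Gamma)\to\mathbb{Z}$; with vertices $v_1,\dots,v_n$ and weighted Laplacian $L$ ($L_{ii}=\mathrm{val}(v_i)$, $L_{ij}=-\sum_{e\in E(v_i,v_j)}w(v_j)/w(e)$ for $i\ne j$), applying $\sigma$ to $D$ yields $D-L\sigma$. Divisors $D,D'$ are linearly equivalent ($D'\in[D]$) if $D'=D-L\sigma$ for some $\sigma$. $D$ is $q$-effective if $D(v)\ge0$ for all $v\ne q$. $D$ is $q$-reduced if: (i) $D$ is $q$-effective; (ii) every $q$-effective $D'\in[D]$ satisfies $D'(q)\le D(q)$; and (iii) if $D'\in[D]$, $D'\ne D$ and $D'(q)=D(q)$, then every firing script $\sigma$ with $\sigma(v)\ge0$ for all $v$ and $D'=D-L\sigma$ has $\sigma(q)\ne0$. The local charge of $q$ is \[c_\ell(q)=\frac{\mathrm{lcm}\left(\gcd_{v\in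 V(\Gamma)}\left(\sum_{e\in E(q,v)}\frac{w(v)}{w(e)}\right),\ \mathrm{val}(q)\right)}{\mathrm{val}(q)}.\] -}

module Defs where

open import Data.Nat as ℕ using (ℕ; zero; suc; NonZero; _/_)
open import Data.Nat.GCD using (gcd)
open import Data.Nat.LCM using (lcm)
open import Data.Nat.Divisibility as ℕD using ()
open import Data.Integer as ℤ using (ℤ; +_; _-_; _*_; _≤_)
open import Data.Fin using (Fin; zero; suc; _≟_)
open import Data.Product using (Σ; _×_; _,_; ∃)
open import Data.Sum using (_⊎_)
open import Relation.Nullary using (¬_; yes; no)
open import Relation.Binary.PropositionalEquality using (_≡_; _≢_)

∑ℕ : ∀ {k} → (Fin k → ℕ) → ℕ
∑ℕ {zero}  f = 0
∑ℕ {suc k} f = f zero ℕ.+ ∑ℕ (λ i → f (suc i))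

∑ℤ : ∀ {k} → (Fin k → ℤ) → ℤ
∑ℤ {zero}  f = + 0
∑ℤ {suc k} f = f zero ℤ.+ ∑ℤ (λ i → f (suc i))

gcdAll : ∀ {k} → (Fin k → ℕ) → ℕ
gcdAll {zero}  f = 0
gcdAll {suc k} f = gcd (f zero) (gcdAll (λ i → f (suc i)))

record WeightedGraph (n m : ℕ) : Set where
  field
    src tgt  : Fin m → Fin n
    noLoop   : ∀ e → src e ≢ tgt e
    wV       : Fin n → ℕ
    wE       : Fin m → ℕ
    wV-pos   : ∀ v → NonZero (wV v)
    wE-pos   : ∀ e → NonZero (wE e)
    wE∣src   : ∀ e → wE e ℕD.∣ wV (src e)
    wE∣tgt   : ∀ e → wE e ℕD.∣ wV (tgt e)

module _ {n m : ℕ} (Γ : WeightedGraph n m) where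
  open WeightedGraph Γ

  ratio : Fin n → Fin m → ℕ
  ratio v e = _/_ (wV v) (wE e) {{wE-pos e}}

  inE : Fin m → Fin n → Set
  inE e v = src e ≡ v ⊎ tgt e ≡ v

  inE2 : Fin m → Fin n → Fin n → Set
  inE2 e u v = (src e ≡ u × tgt e ≡ v) ⊎ (src e ≡ v × tgt e ≡ u)

  incid : Fin n → Fin m → ℕ
  incid v e with src e ≟ v | tgt e ≟ v
  ... | yes _ | _     = ratio v e
  ... | no _  | yes _ = ratio v e
  ... | no _  | no _  = 0

  incid2 : Fin n → Fin n → Fin m → ℕ
  incid2 u v e with src e ≟ u | tgt e ≟ v | src e ≟ v | tgt e ≟ u
  ... | yes _ | yes _ | _     | _     = ratio v e
  ... | yes _ | no _  | yes _ | yes _ = ratio v e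
  ... | no _  | _     | yes _ | yes _ = ratio v e
  ... | _     | _     | _     | _     = 0

  val : Fin n → ℕ
  val v = ∑ℕ (incid v)

  edgeSum : Fin n → Fin n → ℕ
  edgeSum u v = ∑ℕ (incid2 u v)

  Lap : Fin n → Fin n → ℤ
  Lap i j with i ≟ j
  ... | yes _ = + val i
  ... | no _  = ℤ.- (+ edgeSum i j)

  Divisor : Set
  Divisor = Fin n → ℤ

  FiringScript : Set
  FiringScript = Fin n → ℤ

  Lσ : FiringScript → Fin n → ℤ
  Lσ σ i = ∑ℤ (λ j → Lap i j * σ j)

  _≡_-L_ : Divisor → Divisor → FiringScript → Set
  D' ≡ D -L σ = ∀ v → D' v ≡ D v - Lσ σ v

  _∼_ : Divisor → Divisor → Set
  D' ∼ D = Σ FiringScript (λ σ → D' ≡ D -L σ)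

  qEffective : Fin n → Divisor → Set
  qEffective q D = ∀ v → v ≢ q → + 0 ≤ D v

  record qReduced (q : Fin n) (D : Divisor) : Set where
    field
      effective : qEffective q D
      maximal   : ∀ D' → D' ∼ D → qEffective q D' → D' q ≤ D q
      noFire    : ∀ D' σ → D' ≡ D -L σ → ¬ (∀ v → D' v ≡ D v) → D' q ≡ D q
                  → (∀ v → + 0 ≤ σ v) → σ q ≢ + 0

  localCharge : (q : Fin n) → {{NonZero (val q)}} → ℕ
  localCharge q = lcm (gcdAll (edgeSum q)) (val q) / val q

  data Reach : Fin n → Fin n → Set where
    here : ∀ {v} → Reach v v
    step : ∀ {u v w} e → inE2 e u v → Reach v w → Reach u w

  Connected : Set
  Connected = ∀ u v → Reach u v

{-# OPTIONS --safe #-}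
module Submission where

-- D and D' are linearly equivalent and both q-reduced, so by maximality each has
-- at least the other's value at q; hence D(q) = D'(q) and (Lσ)(q) = 0, that is,
-- val(q)·σ(q) = Σ_{v ≠ q} edgeSum(q,v)·σ(v).  The right-hand side is divisible by
-- g = gcd_v edgeSum(q,v), so lcm(g, val q) ∣ val(q)·σ(q), i.e. c_ℓ(q) ∣ σ(q).

open import Defs
open import Data.Nat using (ℕ; NonZero)
open import Data.Integer using (+_)
open import Data.Integer.Divisibility using (_∣_)
open import Data.Fin using (Fin)

import Data.Nat as ℕ
import Data.Nat.Divisibility as ℕD
open import Data.Nat.DivMod using (_/_; m*[n/m]≡n)
open import Data.Nat.GCD using (gcd[m,n]∣m; gcd[m,n]∣n)
open import Data.Nat.LCM using (lcm; lcm-least; n∣lcm[m,n])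
open import Data.Integer using (ℤ; _+_; -_; _-_; _*_; ∣_∣)
import Data.Integer.Properties as ℤP
open import Data.Integer.Divisibility.Signed as Signed
  using (∣ᵤ⇒∣; ∣⇒∣ᵤ; ∣m⇒∣-m; ∣m⇒∣m*n; ∣m∣n⇒∣m+n; ∣m+n∣m⇒∣n; ∣m+n∣n⇒∣m)
open import Data.Fin using (zero; suc; _≟_)
open import Data.Product using (_,_)
open import Relation.Nullary using (yes; no; contradiction)
open import Relation.Binary.PropositionalEquality
open import Algebra.Properties.AbelianGroup ℤP.+-0-abelianGroup using (x≈z//y; ∙-cancelˡ)

gcdAll-∣ : ∀ {k} (f : Fin k → ℕ) j → gcdAll f ℕD.∣ f j
gcdAll-∣ f zero    = gcd[m,n]∣m (f zero) _
gcdAll-∣ f (suc j) = ℕD.∣-trans (gcd[m,n]∣n (f zero) _) (gcdAll-∣ (λ i → f (suc i)) j)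

lcm[m,n]/n∣k : ∀ {m n k} .{{_ : NonZero n}} → m ℕD.∣ n ℕ.* k → lcm m n / n ℕD.∣ k
lcm[m,n]/n∣k {m} {n} {k} m∣nk = ℕD.*-cancelˡ-∣ n n*[lcm/n]∣n*k
  where
  n*[lcm/n]∣n*k : n ℕ.* (lcm m n / n) ℕD.∣ n ℕ.* k
  n*[lcm/n]∣n*k rewrite m*[n/m]≡n (n∣lcm[m,n] m n) = lcm-least m∣nk (ℕD.m∣m*n k)

∑ℤ-cong : ∀ {k} {f g : Fin k → ℤ} → (∀ i → f i ≡ g i) → ∑ℤ f ≡ ∑ℤ g
∑ℤ-cong {ℕ.zero}  f≗g = refl
∑ℤ-cong {ℕ.suc k} f≗g = cong₂ _+_ (f≗g zero) (∑ℤ-cong (λ i → f≗g (suc i)))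

∑ℤ-neg : ∀ {k} (f : Fin k → ℤ) → ∑ℤ (λ i → - f i) ≡ - ∑ℤ f
∑ℤ-neg {ℕ.zero}  f = refl
∑ℤ-neg {ℕ.suc k} f = begin
  - f zero + ∑ℤ (λ i → - f (suc i)) ≡⟨ cong (λ s → - f zero + s) (∑ℤ-neg (λ i → f (suc i))) ⟩
  - f zero + - ∑ℤ (λ i → f (suc i)) ≡⟨ ℤP.neg-distrib-+ (f zero) _ ⟨
  - ∑ℤ f                              ∎
  where open ≡-Reasoning

∣-∑ℤ : ∀ {k} {d : ℤ} (f : Fin k → ℤ) → (∀ j → d Signed.∣ f j) → d Signed.∣ ∑ℤ f
∣-∑ℤ {ℕ.zero}  f d∣f = ∣ᵤ⇒∣ (ℕD.divides 0 refl)
∣-∑ℤ {ℕ.suc k} f d∣f = ∣m∣n⇒∣m+n (d∣f zero) (∣-∑ℤ (λ i → f (suc i)) (λ j → d∣f (suc j)))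

∣-∑ℤ-except : ∀ {k} {d : ℤ} (f : Fin k → ℤ) q →
              (∀ j → j ≢ q → d Signed.∣ f j) → d Signed.∣ ∑ℤ f → d Signed.∣ f q
∣-∑ℤ-except f zero    d∣f d∣∑ =
  ∣m+n∣n⇒∣m d∣∑ (∣-∑ℤ (λ i → f (suc i)) (λ j → d∣f (suc j) (λ ())))
∣-∑ℤ-except f (suc q) d∣f d∣∑ =
  ∣-∑ℤ-except (λ i → f (suc i)) q (λ j j≢q → d∣f (suc j) (λ { refl → j≢q refl }))
    (∣m+n∣m⇒∣n d∣∑ (d∣f zero (λ ())))

module _ {n m : ℕ} (Γ : WeightedGraph n m) where

  Lap-diag : ∀ q → Lap Γ q q ≡ + val Γ q
  Lap-diag q with q ≟ q
  ... | yes _   = refl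
  ... | no q≢q  = contradiction refl q≢q

  Lap-offDiag : ∀ q j → j ≢ q → Lap Γ q j ≡ - (+ edgeSum Γ q j)
  Lap-offDiag q j j≢q with q ≟ j
  ... | yes q≡j = contradiction (sym q≡j) j≢q
  ... | no _    = refl

  Lσ-neg : ∀ σ v → Lσ Γ (λ j → - σ j) v ≡ - Lσ Γ σ v
  Lσ-neg σ v = trans (∑ℤ-cong (λ j → sym (ℤP.neg-distribʳ-* (Lap Γ v j) (σ j))))
                     (∑ℤ-neg (λ j → Lap Γ v j * σ j))

  -L-sym : ∀ {D D' σ} → _≡_-L_ Γ D' D σ → _≡_-L_ Γ D D' (λ j → - σ j)
  -L-sym {D} {D'} {σ} D'≡D-Lσ v =
    trans (x≈z//y (D v) (- Lσ Γ σ v) (D' v) (sym (D'≡D-Lσ v)))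
          (cong (λ s → D' v - s) (sym (Lσ-neg σ v)))

  reduced-agree-at : ∀ q {D D' σ} → qReduced Γ q D → qReduced Γ q D' →
                     _≡_-L_ Γ D' D σ → D' q ≡ D q
  reduced-agree-at q {D} {D'} {σ} rD rD' D'≡D-Lσ = ℤP.≤-antisym
    (qReduced.maximal rD D' (σ , D'≡D-Lσ) (qReduced.effective rD'))
    (qReduced.maximal rD' D (_ , -L-sym D'≡D-Lσ) (qReduced.effective rD))

  Lσ-zero-at : ∀ q {D D' σ} → _≡_-L_ Γ D' D σ → D' q ≡ D q → Lσ Γ σ q ≡ + 0
  Lσ-zero-at q {D} {σ = σ} D'≡D-Lσ D'q≡Dq = ℤP.neg-injective
    (∙-cancelˡ (D q) (- Lσ Γ σ q) (+ 0)
      (trans (sym (D'≡D-Lσ q)) (trans D'q≡Dq (sym (ℤP.+-identityʳ (D q))))))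

  gcd∣val*σ : ∀ q σ → Lσ Γ σ q ≡ + 0 → + gcdAll (edgeSum Γ q) Signed.∣ + val Γ q * σ q
  gcd∣val*σ q σ Lσq≡0 = subst (_ Signed.∣_) (cong (_* σ q) (Lap-diag q))
    (∣-∑ℤ-except (λ j → Lap Γ q j * σ j) q gcd∣offDiag
      (subst (_ Signed.∣_) (sym Lσq≡0) (∣ᵤ⇒∣ (ℕD.divides 0 refl))))
    where
    gcd∣offDiag : ∀ j → j ≢ q → + gcdAll (edgeSum Γ q) Signed.∣ Lap Γ q j * σ j
    gcd∣offDiag j j≢q rewrite Lap-offDiag q j j≢q =
      ∣m⇒∣m*n (σ j) (∣m⇒∣-m {m = + edgeSum Γ q j} (∣ᵤ⇒∣ (gcdAll-∣ (edgeSum Γ q) j)))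

mainTheorem8 : ∀ {n m} (Γ : WeightedGraph n m) → Connected Γ
    → (q : Fin n) → {{_ : NonZero (val Γ q)}}
    → (D D' : Divisor Γ) (σ : FiringScript Γ)
    → qReduced Γ q D → qReduced Γ q D'
    → _≡_-L_ Γ D' D σ
    → (+ localCharge Γ q) ∣ σ q
mainTheorem8 Γ _ q D D' σ rD rD' D'≡D-Lσ = lcm[m,n]/n∣k gcd∣val*∣σq∣
  where
  Lσq≡0 : Lσ Γ σ q ≡ + 0
  Lσq≡0 = Lσ-zero-at Γ q {D} {D'} D'≡D-Lσ (reduced-agree-at Γ q rD rD' D'≡D-Lσ)

  -- The _∣_ of the statement is divisibility of absolute values in ℕ.
  gcd∣val*∣σq∣ : gcdAll (edgeSum Γ q) ℕD.∣ val Γ q ℕ.* ∣ σ q ∣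
  gcd∣val*∣σq∣ = subst (_ ℕD.∣_) (ℤP.abs-* (+ val Γ q) (σ q))
                       (∣⇒∣ᵤ (gcd∣val*σ Γ q σ Lσq≡0))
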